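{- Let $L$ be a finite geometric lattice with set of atoms $A(L)$, fix a total order on $A(L)$, and let $\lambda$ be the corresponding minimum labeling of $L$. Then $\lambda$ is an EW-labeling of $L$.
   Context: The minimum labeling is the edge labeling $\lambda$ that assigns to each cover relation $x\lessdot y$ of $L$ the smallest atom $a$ (in the fixed total order) such that $x\vee a=y$. Labels are compared using the fixed total order on $A(L)$. For a saturated chain $x_0\lessdot\cdots\lessdot x_\ell$ with word of labels $\lambda(x_0\lessdot x_1)\cdots\lambda(x_{\ell-1}\lessdot x_\ell)$, an ascent at $i$ means $\lambda(x_{i-1}\lessdot x_i)<\lambda(x_i\lessdot x_{i+1})$. The chain is increasing if it has ascents at all $i$. An ER-labeling is an edge labeling in which every closed interval has exactly one increasing maximal chain. The rank two switching property holds if, for every maximal chain $\hat0=x_0\lessdot\cdots\lessdot x_k$ with an ascent at rank $i$, there is a unique maximal chain obtained by replacing $x_i$ by some $x_i'$ with $\lambda(x_{i-1}\lessdot x_i')=\lambda(x_i\lessdot x_{i+1})$ and $\lambda(x_i'\lessdot x_{i+1})=\lambda(x_{i-1}\lessdot x_i)$. An EW-labeling is an ER-labeling with the rank two switching property in which, in each interval, distinct maximal chains have distinct words of labels. -}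

module Defs where

open import Level using (0ℓ)
open import Data.Nat using (ℕ)
open import Data.Fin using (Fin)
open import Data.Product using (Σ; ∃; ∃-syntax; _×_; _,_)
open import Data.Sum using (_⊎_)
open import Data.Unit using (⊤)
open import Data.List using (List; []; _∷_; foldr)
open import Data.List.Relation.Unary.All using (All)
open import Relation.Nullary using (¬_)
open import Relation.Binary.Core using (Rel)
open import Relation.Binary.PropositionalEquality using (_≡_; _≢_)
open import Relation.Binary.Lattice.Structures using (IsBoundedLattice)
open import Algebra.Core using (Op₂)
open import Function.Bundles using (_↔_)

record FiniteLattice : Set₁ where
  field
    Carrier          : Set
    _≤_              : Rel Carrier 0ℓ
    _∨_              : Op₂ Carrier
    _∧_              : Op₂ Carrier
    𝟙                : Carrier
    𝟘                : Carrier
    isBoundedLattice : IsBoundedLattice _≡_ _≤_ _∨_ _∧_ 𝟙 𝟘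
    finite           : ∃[ n ] (Carrier ↔ Fin n)

module LatticeNotions (L : FiniteLattice) where
  open FiniteLattice L

  _<_ : Rel Carrier 0ℓ
  x < y = (x ≤ y) × (x ≢ y)

  _⋖_ : Rel Carrier 0ℓ
  x ⋖ y = (x < y) × (∀ z → x ≤ z → z ≤ y → (z ≡ x) ⊎ (z ≡ y))

  IsAtom : Carrier → Set
  IsAtom a = 𝟘 ⋖ a

  ⋁ : List Carrier → Carrier
  ⋁ = foldr _∨_ 𝟘

  Atomistic : Set
  Atomistic = ∀ x → ∃[ as ] (All IsAtom as × x ≡ ⋁ as)

  Semimodular : Set
  Semimodular = ∀ x y → (x ∧ y) ⋖ x → y ⋖ (x ∨ y)

  IsGeometric : Set
  IsGeometric = Atomistic × Semimodular

  -- a strict total order on the set A(L) of atoms, given as a relation on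
  -- the carrier whose restriction to atoms is a strict total order
  record IsTotalOrderOnAtoms (_◁_ : Rel Carrier 0ℓ) : Set where
    field
      irrefl : ∀ {a} → IsAtom a → ¬ (a ◁ a)
      trans  : ∀ {a b c} → IsAtom a → IsAtom b → IsAtom c →
               a ◁ b → b ◁ c → a ◁ c
      total  : ∀ {a b} → IsAtom a → IsAtom b → (a ◁ b) ⊎ (a ≡ b) ⊎ (b ◁ a)

  -- edge labelings: a label (element of L, an atom for the minimum
  -- labeling) for each cover relation
  EdgeLabeling : Set
  EdgeLabeling = ∀ x y → x ⋖ y → Carrier

  IsMinimumLabeling : Rel Carrier 0ℓ → EdgeLabeling → Set
  IsMinimumLabeling _◁_ λ′ =
    ∀ x y (c : x ⋖ y) →
      IsAtom (λ′ x y c) × ((x ∨ λ′ x y c) ≡ y) ×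
      (∀ b → IsAtom b → (x ∨ b) ≡ y → (λ′ x y c ≡ b) ⊎ (λ′ x y c ◁ b))

  -- saturated chains x = x₀ ⋖ x₁ ⋖ ⋯ ⋖ xₗ = y (maximal chains of [x , y])
  data Chain : Carrier → Carrier → Set where
    done : ∀ x → Chain x x
    step : ∀ {x y z} → x ⋖ y → Chain y z → Chain x z

  elems : ∀ {x y} → Chain x y → List Carrier
  elems (done x) = x ∷ []
  elems (step {x} _ c) = x ∷ elems c

  word : EdgeLabeling → ∀ {x y} → Chain x y → List Carrier
  word λ′ (done x) = []
  word λ′ (step {x} {y} p c) = λ′ x y p ∷ word λ′ c

  module _ (_◁_ : Rel Carrier 0ℓ) (λ′ : EdgeLabeling) where

    IncreasingWord : List Carrier → Set
    IncreasingWord [] = ⊤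
    IncreasingWord (a ∷ []) = ⊤
    IncreasingWord (a ∷ b ∷ w) = (a ◁ b) × IncreasingWord (b ∷ w)

    Increasing : ∀ {x y} → Chain x y → Set
    Increasing c = IncreasingWord (word λ′ c)

    IsER : Set
    IsER = ∀ x y → x ≤ y →
      Σ (Chain x y) λ c → Increasing c ×
        (∀ (c′ : Chain x y) → Increasing c′ → elems c′ ≡ elems c)

    -- rank two switching property: for every maximal chain
    --   𝟘 = x₀ ⋖ ⋯ ⋖ x_{i-1} ⋖ x_i ⋖ x_{i+1} ⋖ ⋯ ⋖ x_k = 𝟙
    -- (p the part from 𝟘 to x_{i-1}, s the part from x_{i+1} to 𝟙) with an
    -- ascent at rank i, there is a unique x_i' such that replacing x_i by
    -- x_i' gives a maximal chain with the two labels switched.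
    SwitchAt : ∀ {x y z} → x ⋖ y → y ⋖ z → Carrier → Set
    SwitchAt {x} {y} {z} c₁ c₂ y′ =
      Σ (x ⋖ y′) λ d₁ → Σ (y′ ⋖ z) λ d₂ →
        (λ′ x y′ d₁ ≡ λ′ y z c₂) × (λ′ y′ z d₂ ≡ λ′ x y c₁)

    RankTwoSwitching : Set
    RankTwoSwitching =
      ∀ x y z (p : Chain 𝟘 x) (c₁ : x ⋖ y) (c₂ : y ⋖ z) (s : Chain z 𝟙) →
        λ′ x y c₁ ◁ λ′ y z c₂ →
        Σ Carrier λ y′ → SwitchAt c₁ c₂ y′ ×
          (∀ y″ → SwitchAt c₁ c₂ y″ → y″ ≡ y′)

    DistinctWords : Set
    DistinctWords = ∀ x y (c c′ : Chain x y) →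
      word λ′ c ≡ word λ′ c′ → elems c ≡ elems c′

    IsEW : Set
    IsEW = IsER × RankTwoSwitching × DistinctWords

module Submission where

-- The whole proof rests on one observation: the label
-- of a cover x ⋖ y is the ◁-least atom d with d ≤ y and d ≰ x
-- ('label-least').  From it:
--   * in an increasing chain from x to y the first label is the ◁-least atom
--     below y and not below x; since a cover x ⋖ x′ is determined by its
--     label (x′ = x ∨ λ), increasing chains of an interval are unique, and
--     equal words force equal chains (no geometry is needed for either);
--   * in a geometric lattice the greedy chain — repeatedly join the least
--     new atom below y — exists (atomicity provides new atoms, semimodularity
--     makes each join a cover, finiteness ends the recursion) and is
--     increasing;
--   * for x ⋖ y ⋖ z with labels a ◁ b, the element x ∨ b completes a diamond
--     with x, y, z (semimodularity) whose labels are b, a, and it is the only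
--     element doing so.

open import Defs
open import Level using (0ℓ)
open import Relation.Binary.Core using (Rel)
open import Data.Fin.Induction using (spo-noetherian)
import Data.Fin.Properties as Fin
open import Data.Product using (Σ; ∃; ∃-syntax; _×_; _,_; proj₁; proj₂)
open import Data.Sum using (_⊎_; inj₁; inj₂)
open import Data.Unit using (tt)
open import Data.Empty using (⊥-elim)
open import Data.List using (List; []; _∷_; map; allFin)
open import Data.List.Properties using (∷-injectiveˡ; ∷-injectiveʳ)
open import Data.List.Relation.Unary.All as All using (All; []; _∷_)
open import Data.List.Relation.Unary.Any using (here; there)
open import Data.List.Membership.Propositional using (_∈_)
open import Data.List.Membership.Propositional.Properties using (∈-map⁺; ∈-allFin)
open import Function using (flip)
open import Function.Bundles using (Inverse)
open import Function.Properties.Inverse using (↔⇒↣)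
open import Induction.WellFounded using (WellFounded; Acc; acc; module Subrelation)
open import Relation.Binary.Lattice.Bundles using (JoinSemilattice)
open import Relation.Binary.Lattice.Structures using (IsBoundedLattice)
import Relation.Binary.Lattice.Properties.JoinSemilattice as JoinProperties
import Relation.Binary.Construct.NonStrictToStrict as ToStrict
import Relation.Binary.Construct.On as On
open import Relation.Nullary using (¬_; Dec; yes; no)
open import Relation.Nullary.Decidable using (map′; _×-dec_; _⊎-dec_; _→-dec_; ¬?)
open import Relation.Unary using (Pred; Decidable)
open import Relation.Binary.PropositionalEquality
  using (_≡_; _≢_; refl; sym; trans; cong; subst; subst₂)

module LatticeFacts (L : FiniteLattice) where
  open FiniteLattice L
  open LatticeNotions L
  open IsBoundedLattice isBoundedLattice public
    using (isPartialOrder; minimum; x≤x∨y; y≤x∨y; ∨-least; x∧y≤x; x∧y≤y; ∧-greatest)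
    renaming (refl to ≤-refl; trans to ≤-trans; antisym to ≤-antisym)

  -- L as a join semilattice, to reuse the library's join laws.
  joinSemilattice : JoinSemilattice 0ℓ 0ℓ 0ℓ
  joinSemilattice = record
    { Carrier = Carrier ; _≈_ = _≡_ ; _≤_ = _≤_ ; _∨_ = _∨_
    ; isJoinSemilattice = IsBoundedLattice.isJoinSemilattice isBoundedLattice }

  open JoinProperties joinSemilattice public using (∨-comm; x≤y⇒x∨y≈y)

  ∨-absorb : ∀ {x y} → y ≤ x → x ∨ y ≡ x
  ∨-absorb {x} {y} y≤x = trans (∨-comm x y) (x≤y⇒x∨y≈y y≤x)

  -- Finiteness makes equality, the order and the atom property decidable.
  open Inverse (proj₂ finite) using (to; from; strictlyInverseʳ)

  _≟_ : (x y : Carrier) → Dec (x ≡ y)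
  _≟_ = Fin.inj⇒≟ (↔⇒↣ (proj₂ finite))

  _≤?_ : (x y : Carrier) → Dec (x ≤ y)
  x ≤? y = map′ (λ e → subst (x ≤_) e (x≤x∨y x y)) x≤y⇒x∨y≈y ((x ∨ y) ≟ y)

  ∀-dec : {P : Pred Carrier 0ℓ} → Decidable P → Dec (∀ z → P z)
  ∀-dec {P} P? = map′ (λ h z → subst P (strictlyInverseʳ z) (h (to z)))
                      (λ h i → h (from i)) (Fin.all? (λ i → P? (from i)))

  isAtom? : Decidable IsAtom
  isAtom? a = map′ (λ { (a≢𝟘 , below) → (minimum a , λ e → a≢𝟘 (sym e)) , λ z _ → below z })
                   (λ at → (λ e → proj₂ (proj₁ at) (sym e)) , λ z → proj₂ at z (minimum z))
                   (¬? (a ≟ 𝟘) ×-dec ∀-dec (λ z → (z ≤? a) →-dec ((z ≟ 𝟘) ⊎-dec (z ≟ a))))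

  elements : List Carrier
  elements = map from (allFin (proj₁ finite))

  ∈-elements : ∀ x → x ∈ elements
  ∈-elements x = subst (_∈ elements) (strictlyInverseʳ x) (∈-map⁺ from (∈-allFin (to x)))

  -- A finite poset has no infinite ascending chains; this drives the
  -- construction of chains upwards.
  <-noetherian : WellFounded (flip _<_)
  <-noetherian = Subrelation.wellFounded transport
    (On.wellFounded to (spo-noetherian (On.isStrictPartialOrder from strictOrder)))
    where
    strictOrder = ToStrict.<-isStrictPartialOrder _≡_ _≤_ isPartialOrder
    transport : ∀ {x y} → y < x → from (to y) < from (to x)
    transport {x} {y} = subst₂ _<_ (sym (strictlyInverseʳ y)) (sym (strictlyInverseʳ x))

  chain-≤ : ∀ {x y} → Chain x y → x ≤ y
  chain-≤ (done _) = ≤-refl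
  chain-≤ (step p c) = ≤-trans (proj₁ (proj₁ p)) (chain-≤ c)

  cover-join : ∀ {x y c} → x ⋖ y → c ≤ y → ¬ c ≤ x → x ∨ c ≡ y
  cover-join {x} {y} {c} x⋖y c≤y c≰x
    with proj₂ x⋖y (x ∨ c) (x≤x∨y x c) (∨-least (proj₁ (proj₁ x⋖y)) c≤y)
  ... | inj₁ e = ⊥-elim (c≰x (subst (c ≤_) e (y≤x∨y x c)))
  ... | inj₂ e = e

  atom-meet : ∀ {a x} → IsAtom a → ¬ a ≤ x → a ∧ x ≡ 𝟘
  atom-meet {a} {x} at a≰x with proj₂ at (a ∧ x) (minimum _) (x∧y≤x a x)
  ... | inj₁ e = e
  ... | inj₂ e = ⊥-elim (a≰x (subst (_≤ x) e (x∧y≤y a x)))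

  covers-meet : ∀ {x y y′} → x ⋖ y → x ⋖ y′ → y ≢ y′ → y ∧ y′ ≡ x
  covers-meet {x} {y} {y′} x⋖y x⋖y′ y≢y′
    with proj₂ x⋖y (y ∧ y′) (∧-greatest (proj₁ (proj₁ x⋖y)) (proj₁ (proj₁ x⋖y′))) (x∧y≤x y y′)
  ... | inj₁ e = e
  ... | inj₂ e with proj₂ x⋖y′ y (proj₁ (proj₁ x⋖y)) (subst (_≤ y′) e (x∧y≤y y y′))
  ...   | inj₁ y≡x = ⊥-elim (proj₂ (proj₁ x⋖y) (sym y≡x))
  ...   | inj₂ y≡y′ = ⊥-elim (y≢y′ y≡y′)

module AtomOrder (L : FiniteLattice) (_◁_ : Rel (FiniteLattice.Carrier L) 0ℓ)
  (total : LatticeNotions.IsTotalOrderOnAtoms L _◁_) where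
  open FiniteLattice L
  open LatticeNotions L
  open LatticeFacts L using (elements; ∈-elements)
  open IsTotalOrderOnAtoms total renaming (irrefl to ◁-irrefl; trans to ◁-trans; total to ◁-total)

  _⊴_ : Rel Carrier 0ℓ
  a ⊴ b = (a ≡ b) ⊎ (a ◁ b)

  ⊴-antisym : ∀ {a b} → IsAtom a → IsAtom b → a ⊴ b → b ⊴ a → a ≡ b
  ⊴-antisym _ _ (inj₁ a≡b) _ = a≡b
  ⊴-antisym _ _ (inj₂ _) (inj₁ b≡a) = sym b≡a
  ⊴-antisym aa ab (inj₂ a◁b) (inj₂ b◁a) = ⊥-elim (◁-irrefl aa (◁-trans aa ab aa a◁b b◁a))

  ◁-⊴-trans : ∀ {a b c} → IsAtom a → IsAtom b → IsAtom c → a ◁ b → b ⊴ c → a ◁ c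
  ◁-⊴-trans _ _ _ a◁b (inj₁ refl) = a◁b
  ◁-⊴-trans aa ab ac a◁b (inj₂ b◁c) = ◁-trans aa ab ac a◁b b◁c

  ⊴-◁-trans : ∀ {a b c} → IsAtom a → IsAtom b → IsAtom c → a ⊴ b → b ◁ c → a ◁ c
  ⊴-◁-trans _ _ _ (inj₁ refl) b◁c = b◁c
  ⊴-◁-trans aa ab ac (inj₂ a◁b) b◁c = ◁-trans aa ab ac a◁b b◁c

  ⊴-trans : ∀ {a b c} → IsAtom a → IsAtom b → IsAtom c → a ⊴ b → b ⊴ c → a ⊴ c
  ⊴-trans _ _ _ (inj₁ refl) b⊴c = b⊴c
  ⊴-trans aa ab ac (inj₂ a◁b) b⊴c = inj₂ (◁-⊴-trans aa ab ac a◁b b⊴c)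

  ◁-⊴-asym : ∀ {a b} → IsAtom a → IsAtom b → a ◁ b → ¬ b ⊴ a
  ◁-⊴-asym aa ab a◁b b⊴a = ◁-irrefl aa (◁-⊴-trans aa ab aa a◁b b⊴a)

  module _ {P : Pred Carrier 0ℓ} (P? : Decidable P) (atomic : ∀ {a} → P a → IsAtom a) where

    least-in : ∀ l → All (λ z → ¬ P z) l ⊎ (∃[ m ] P m × All (λ z → P z → m ⊴ z) l)
    least-in [] = inj₁ []
    least-in (d ∷ l) with P? d | least-in l
    ... | no ¬pd | inj₁ none = inj₁ (¬pd ∷ none)
    ... | no ¬pd | inj₂ (m , pm , below) = inj₂ (m , pm , (λ pd → ⊥-elim (¬pd pd)) ∷ below)
    ... | yes pd | inj₁ none = inj₂ (d , pd , (λ _ → inj₁ refl) ∷ All.map (λ ¬pz pz → ⊥-elim (¬pz pz)) none)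
    ... | yes pd | inj₂ (m , pm , below) with ◁-total (atomic pm) (atomic pd)
    ...   | inj₁ m◁d = inj₂ (m , pm , (λ _ → inj₂ m◁d) ∷ below)
    ...   | inj₂ (inj₁ m≡d) = inj₂ (m , pm , (λ _ → inj₁ m≡d) ∷ below)
    ...   | inj₂ (inj₂ d◁m) = inj₂ (d , pd , (λ _ → inj₁ refl) ∷ All.map d⊴ below)
      where
      d⊴ : ∀ {z} → (P z → m ⊴ z) → P z → d ⊴ z
      d⊴ m⊴ pz = inj₂ (◁-⊴-trans (atomic pd) (atomic pm) (atomic pz) d◁m (m⊴ pz))

    least : ∃ P → ∃[ m ] P m × (∀ {z} → P z → m ⊴ z)
    least (w , pw) with least-in elements
    ... | inj₁ none = ⊥-elim (All.lookup none (∈-elements w) pw)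
    ... | inj₂ (m , pm , below) = m , pm , λ {z} pz → All.lookup below (∈-elements z) pz

module MinimumLabeling (L : FiniteLattice) (_◁_ : Rel (FiniteLattice.Carrier L) 0ℓ)
  (total : LatticeNotions.IsTotalOrderOnAtoms L _◁_)
  (λ′ : LatticeNotions.EdgeLabeling L)
  (minimal : LatticeNotions.IsMinimumLabeling L _◁_ λ′) where
  open FiniteLattice L
  open LatticeNotions L
  open LatticeFacts L
  open AtomOrder L _◁_ total
  open IsTotalOrderOnAtoms total using () renaming (trans to ◁-trans)

  Increasing′ : ∀ {x y} → Chain x y → Set
  Increasing′ = Increasing _◁_ λ′

  label-atom : ∀ {x y} (p : x ⋖ y) → IsAtom (λ′ x y p)
  label-atom p = proj₁ (minimal _ _ p)

  label-join : ∀ {x y} (p : x ⋖ y) → x ∨ λ′ x y p ≡ y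
  label-join p = proj₁ (proj₂ (minimal _ _ p))

  label-≤ : ∀ {x y} (p : x ⋖ y) → λ′ x y p ≤ y
  label-≤ {x} p = subst (_ ≤_) (label-join p) (y≤x∨y x _)

  label-≰ : ∀ {x y} (p : x ⋖ y) → ¬ λ′ x y p ≤ x
  label-≰ p λ≤x = proj₂ (proj₁ p) (trans (sym (∨-absorb λ≤x)) (label-join p))

  label-least : ∀ {x y d} (p : x ⋖ y) → IsAtom d → d ≤ y → ¬ d ≤ x → λ′ x y p ⊴ d
  label-least p at d≤y d≰x = proj₂ (proj₂ (minimal _ _ p)) _ at (cover-join p d≤y d≰x)

  label-determines : ∀ {x y y′} (p : x ⋖ y) (p′ : x ⋖ y′) →
    λ′ x y p ≡ λ′ x y′ p′ → y ≡ y′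
  label-determines {x} p p′ e = trans (sym (label-join p)) (trans (cong (x ∨_) e) (label-join p′))

  word-atoms : ∀ {x y} (c : Chain x y) → All IsAtom (word λ′ c)
  word-atoms (done _) = []
  word-atoms (step p c) = label-atom p ∷ word-atoms c

  increasing-tail : ∀ a w → IncreasingWord _◁_ λ′ (a ∷ w) → IncreasingWord _◁_ λ′ w
  increasing-tail a [] _ = tt
  increasing-tail a (b ∷ w) (_ , inc) = inc

  increasing-head : ∀ a w → IsAtom a → All IsAtom w →
    IncreasingWord _◁_ λ′ (a ∷ w) → All (a ◁_) w
  increasing-head a [] _ _ _ = []
  increasing-head a (b ∷ w) aa (ab ∷ aw) (a◁b , inc) =
    a◁b ∷ All.zipWith (λ (ac , b◁c) → ◁-trans aa ab ac a◁b b◁c)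
                      (aw , increasing-head b w ab aw inc)

  -- Every atom d with d ≤ y and d ≰ x lies ⊴-above some label of any chain
  -- from x to y (namely the label of the step where d first appears).
  some-label-below : ∀ {x y d} (c : Chain x y) → IsAtom d → d ≤ y → ¬ d ≤ x →
    ∃[ e ] e ∈ word λ′ c × e ⊴ d
  some-label-below (done _) _ d≤y d≰x = ⊥-elim (d≰x d≤y)
  some-label-below {d = d} (step {y = x₁} p c) at d≤y d≰x with d ≤? x₁
  ... | yes d≤x₁ = _ , here refl , label-least p at d≤x₁ d≰x
  ... | no d≰x₁ with some-label-below c at d≤y d≰x₁
  ...   | e , e∈ , e⊴d = e , there e∈ , e⊴d

  first-label-least : ∀ {x x₁ y d} (p : x ⋖ x₁) (c : Chain x₁ y) →
    Increasing′ (step p c) → IsAtom d → d ≤ y → ¬ d ≤ x → λ′ x x₁ p ⊴ d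
  first-label-least p c inc at d≤y d≰x with some-label-below (step p c) at d≤y d≰x
  ... | e , here refl , e⊴d = e⊴d
  ... | e , there e∈ , e⊴d =
    inj₂ (◁-⊴-trans (label-atom p) (All.lookup (word-atoms c) e∈) at
           (All.lookup (increasing-head _ _ (label-atom p) (word-atoms c) inc) e∈) e⊴d)

  same-first-label : ∀ {x x₁ x₁′ y} (p : x ⋖ x₁) (c : Chain x₁ y) (p′ : x ⋖ x₁′) (c′ : Chain x₁′ y) →
    Increasing′ (step p c) → Increasing′ (step p′ c′) → λ′ x x₁ p ≡ λ′ x x₁′ p′
  same-first-label p c p′ c′ inc inc′ = ⊴-antisym (label-atom p) (label-atom p′)
    (first-label-least p c inc (label-atom p′) (≤-trans (label-≤ p′) (chain-≤ c′)) (label-≰ p′))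
    (first-label-least p′ c′ inc′ (label-atom p) (≤-trans (label-≤ p) (chain-≤ c)) (label-≰ p))

  increasing-unique : ∀ {x y} (c c′ : Chain x y) → Increasing′ c → Increasing′ c′ →
    elems c ≡ elems c′
  increasing-unique (done _) (done _) _ _ = refl
  increasing-unique (done _) (step p c′) _ _ =
    ⊥-elim (proj₂ (proj₁ p) (≤-antisym (proj₁ (proj₁ p)) (chain-≤ c′)))
  increasing-unique (step p c) (done _) _ _ =
    ⊥-elim (proj₂ (proj₁ p) (≤-antisym (proj₁ (proj₁ p)) (chain-≤ c)))
  increasing-unique {x} (step p c) (step p′ c′) inc inc′
    with label-determines p p′ (same-first-label p c p′ c′ inc inc′)
  ... | refl = cong (x ∷_) (increasing-unique c c′
                   (increasing-tail _ _ inc) (increasing-tail _ _ inc′))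

  distinct-words : DistinctWords _◁_ λ′
  distinct-words x y (done _) (done _) _ = refl
  distinct-words x y (step p c) (step p′ c′) w≡w′ with label-determines p p′ (∷-injectiveˡ w≡w′)
  ... | refl = cong (x ∷_) (distinct-words _ y c c′ (∷-injectiveʳ w≡w′))

module SemimodularFacts (L : FiniteLattice) (semimodular : LatticeNotions.Semimodular L) where
  open FiniteLattice L
  open LatticeNotions L
  open LatticeFacts L

  join-cover : ∀ {a x} → IsAtom a → ¬ a ≤ x → x ⋖ (x ∨ a)
  join-cover {a} {x} at a≰x =
    subst (x ⋖_) (∨-comm a x) (semimodular a x (subst (_⋖ a) (sym (atom-meet at a≰x)) at))

  diamond : ∀ {x y y′} → x ⋖ y → x ⋖ y′ → y ≢ y′ → y′ ⋖ (y ∨ y′)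
  diamond x⋖y x⋖y′ y≢y′ =
    semimodular _ _ (subst (_⋖ _) (sym (covers-meet x⋖y x⋖y′ y≢y′)) x⋖y)

module GeometricLabeling (L : FiniteLattice) (geometric : LatticeNotions.IsGeometric L)
  (_◁_ : Rel (FiniteLattice.Carrier L) 0ℓ)
  (total : LatticeNotions.IsTotalOrderOnAtoms L _◁_)
  (λ′ : LatticeNotions.EdgeLabeling L)
  (minimal : LatticeNotions.IsMinimumLabeling L _◁_ λ′) where
  open FiniteLattice L
  open LatticeNotions L
  open LatticeFacts L
  open AtomOrder L _◁_ total
  open MinimumLabeling L _◁_ total λ′ minimal
  open SemimodularFacts L (proj₂ geometric)

  NewAtom : Carrier → Carrier → Pred Carrier 0ℓ
  NewAtom x y d = IsAtom d × d ≤ y × ¬ d ≤ x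

  newAtom? : ∀ x y → Decidable (NewAtom x y)
  newAtom? x y d = isAtom? d ×-dec (d ≤? y) ×-dec ¬? (d ≤? x)

  new-atom-exists : ∀ {x y} → x ≤ y → x ≢ y → ∃ (NewAtom x y)
  new-atom-exists {x} {y} x≤y x≢y with proj₁ geometric y
  ... | as , atoms , refl = search as atoms (λ ⋁≤x → x≢y (≤-antisym x≤y ⋁≤x))
    where
    search : ∀ as → All IsAtom as → ¬ ⋁ as ≤ x → ∃[ d ] IsAtom d × d ≤ ⋁ as × ¬ d ≤ x
    search [] _ 𝟘≰x = ⊥-elim (𝟘≰x (minimum x))
    search (a ∷ as) (at ∷ atoms) ⋁≰x with a ≤? x
    ... | no a≰x = a , at , x≤x∨y a (⋁ as) , a≰x
    ... | yes a≤x with search as atoms (λ ⋁≤x → ⋁≰x (∨-least a≤x ⋁≤x))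
    ...   | d , ad , d≤ , d≰x = d , ad , ≤-trans d≤ (y≤x∨y a (⋁ as)) , d≰x

  extend-increasing : ∀ {x x′ y} (p : x ⋖ x′) (c : Chain x′ y) → Increasing′ c →
    (∀ {d} → NewAtom x y d → λ′ x x′ p ⊴ d) → Increasing′ (step p c)
  extend-increasing p (done _) _ _ = tt
  extend-increasing p (step q c) inc least-label = label-precedes , inc
    where
    next-is-new : NewAtom _ _ (λ′ _ _ q)
    next-is-new = label-atom q , ≤-trans (label-≤ q) (chain-≤ c) ,
                  λ ℓ≤x → label-≰ q (≤-trans ℓ≤x (proj₁ (proj₁ p)))
    label-precedes : λ′ _ _ p ◁ λ′ _ _ q
    label-precedes with least-label next-is-new
    ... | inj₁ λp≡λq = ⊥-elim (label-≰ q (subst (_≤ _) λp≡λq (label-≤ p)))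
    ... | inj₂ λp◁λq = λp◁λq

  greedy-chain : ∀ {x y} → Acc (flip _<_) x → x ≤ y → Σ (Chain x y) Increasing′
  greedy-chain {x} {y} (acc above) x≤y with x ≟ y
  ... | yes refl = done x , tt
  ... | no x≢y = go-up (least (newAtom? x y) proj₁ (new-atom-exists x≤y x≢y))
    where
    go-up : (∃[ a ] NewAtom x y a × (∀ {d} → NewAtom x y d → a ⊴ d)) → Σ (Chain x y) Increasing′
    go-up (a , (at , a≤y , a≰x) , a-least) =
      step cover (proj₁ rest) , extend-increasing cover (proj₁ rest) (proj₂ rest) label-least-new
      where
      cover : x ⋖ (x ∨ a)
      cover = join-cover at a≰x
      rest : Σ (Chain (x ∨ a) y) Increasing′
      rest = greedy-chain (above (proj₁ cover)) (∨-least x≤y a≤y)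
      label-least-new : ∀ {d} → NewAtom x y d → λ′ x (x ∨ a) cover ⊴ d
      label-least-new new = ⊴-trans (label-atom cover) at (proj₁ new)
        (label-least cover at (y≤x∨y x a) a≰x) (a-least new)

  isER : IsER _◁_ λ′
  isER x y x≤y with greedy-chain (<-noetherian x) x≤y
  ... | c , inc = c , inc , λ c′ inc′ → increasing-unique c′ c inc′ inc

  module Switch {x y z : Carrier} (c₁ : x ⋖ y) (c₂ : y ⋖ z) where
    a b y′ : Carrier
    a = λ′ x y c₁
    b = λ′ y z c₂
    y′ = x ∨ b

    x≤y : x ≤ y
    x≤y = proj₁ (proj₁ c₁)

    y≤z : y ≤ z
    y≤z = proj₁ (proj₁ c₂)

    b≰x : ¬ b ≤ x
    b≰x b≤x = label-≰ c₂ (≤-trans b≤x x≤y)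

    x⋖y′ : x ⋖ y′
    x⋖y′ = join-cover (label-atom c₂) b≰x

    y′≰y : ¬ y′ ≤ y
    y′≰y y′≤y = label-≰ c₂ (≤-trans (y≤x∨y x b) y′≤y)

    y≢y′ : y ≢ y′
    y≢y′ y≡y′ = y′≰y (subst (_≤ y) y≡y′ ≤-refl)

    y′≤z : y′ ≤ z
    y′≤z = ∨-least (≤-trans x≤y y≤z) (label-≤ c₂)

    y′⋖z : y′ ⋖ z
    y′⋖z = subst (y′ ⋖_) (cover-join c₂ y′≤z y′≰y) (diamond c₁ x⋖y′ y≢y′)

    a≰y′ : ¬ a ≤ y′
    a≰y′ a≤y′ with proj₂ x⋖y′ y x≤y (subst (_≤ y′) (label-join c₁) (∨-least (proj₁ (proj₁ x⋖y′)) a≤y′))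
    ... | inj₁ y≡x = proj₂ (proj₁ c₁) (sym y≡x)
    ... | inj₂ y≡y′ = y≢y′ y≡y′

    first-label : λ′ x y′ x⋖y′ ≡ b
    first-label = ⊴-antisym (label-atom x⋖y′) (label-atom c₂)
      (label-least x⋖y′ (label-atom c₂) (y≤x∨y x b) b≰x)
      (label-least c₂ (label-atom x⋖y′) (≤-trans (label-≤ x⋖y′) y′≤z) label≰y)
      where
      label≰y : ¬ λ′ x y′ x⋖y′ ≤ y
      label≰y ℓ≤y = y′≰y (subst (_≤ y) (label-join x⋖y′) (∨-least x≤y ℓ≤y))

    second-label : a ◁ b → λ′ y′ z y′⋖z ≡ a
    second-label a◁b = ⊴-antisym af aa f⊴a a⊴f
      where
      f = λ′ y′ z y′⋖z
      af = label-atom y′⋖z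
      aa = label-atom c₁
      f⊴a : f ⊴ a
      f⊴a = label-least y′⋖z aa (≤-trans (label-≤ c₁) y≤z) a≰y′
      a⊴f : a ⊴ f
      a⊴f with f ≤? y
      ... | yes f≤y = label-least c₁ af f≤y (λ f≤x → label-≰ y′⋖z (≤-trans f≤x (proj₁ (proj₁ x⋖y′))))
      ... | no f≰y = ⊥-elim (◁-⊴-asym af (label-atom c₂) (⊴-◁-trans af aa (label-atom c₂) f⊴a a◁b)
                                        (label-least c₂ af (label-≤ y′⋖z) f≰y))

    switch-unique : ∀ y″ → SwitchAt _◁_ λ′ c₁ c₂ y″ → y″ ≡ y′
    switch-unique y″ (x⋖y″ , _ , label≡b , _) = trans (sym (label-join x⋖y″)) (cong (x ∨_) label≡b)

  rankTwoSwitching : RankTwoSwitching _◁_ λ′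
  rankTwoSwitching x y z _ c₁ c₂ _ a◁b =
    y′ , (x⋖y′ , y′⋖z , first-label , second-label a◁b) , switch-unique
    where open Switch c₁ c₂

proposition5p3 : (L : FiniteLattice) → LatticeNotions.IsGeometric L →
    (_◁_ : Rel (FiniteLattice.Carrier L) 0ℓ) →
    LatticeNotions.IsTotalOrderOnAtoms L _◁_ →
    (λ′ : LatticeNotions.EdgeLabeling L) →
    LatticeNotions.IsMinimumLabeling L _◁_ λ′ →
    LatticeNotions.IsEW L _◁_ λ′
proposition5p3 L geometric _◁_ total λ′ minimal =
  isER , rankTwoSwitching , distinct-words
  where
  open MinimumLabeling L _◁_ total λ′ minimal using (distinct-words)
  open GeometricLabeling L geometric _◁_ total λ′ minimal using (isER; rankTwoSwitching)
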